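{- Let $G$ be a split graph with vertex set partitioned as $I\cup C$, where $C=\{u_1,\ldots,u_k\}$ is a clique, $I=\{v_1,\ldots,v_t\}$ is an independent set, and no vertex of $I$ is adjacent to all vertices of $C$. Let $M(G)$ be the $k\times t$ $(0,1)$-matrix with entries $m_{ij}=1$ if and only if $u_i$ is adjacent to $v_j$. Then $G$ is semi-transitive if and only if the rows of $M(G)$ can be permuted in such a way that: (i) in every column, either the ones occupy consecutive rows or the zeroes occupy consecutive rows (circular ones property for all columns); and (ii) if some column has the form $1^a0^b1^c$ (read from top to bottom) with $a+b+c=k$ and $a,b,c\ge 1$, then no other column contains ones in all positions from $a$ to $a+b+1$.
   Context: A directed graph is semi-transitive if it is acyclic and for every directed path $w_1\to w_2\to\cdots\to w_s$ with $s\ge 2$, either there is no edge from $w_1$ to $w_s$, or all edges $w_i\to w_j$ exist for $1\le i<j\le s$. An undirected graph is semi-transitive if it admits an orientation that is semi-transitive. A split graph is a graph whose vertex set can be partitioned into a clique $C$ and an independent set $I$; here the clique is taken maximal in the sense that no vertex of $I$ is adjacent to all of $C$. -}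

module Defs where

open import Data.Nat using (ℕ; zero; suc; _+_; _∸_; _≤_; _<_)
open import Data.Fin using (Fin; zero; suc; toℕ; inject₁; fromℕ; _≟_)
open import Data.Fin.Permutation using (Permutation′; _⟨$⟩ʳ_)
open import Data.Bool using (Bool; true; false; not)
open import Data.Sum using (_⊎_; inj₁; inj₂)
open import Data.Product using (Σ; _×_)
open import Relation.Binary.PropositionalEquality using (_≡_; _≢_)
open import Relation.Nullary using (¬_)
open import Relation.Nullary.Decidable using (⌊_⌋)

-- A (simple, undirected) graph is given by a vertex type V and a
-- symmetric, irreflexive adjacency function E : V → V → Bool.
record IsOrientation {V : Set} (E : V → V → Bool) (O : V → V → Bool) : Set where
  field
    sub     : ∀ x y → O x y ≡ true → E x y ≡ true
    covers  : ∀ x y → E x y ≡ true → (O x y ≡ true) ⊎ (O y x ≡ true)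
    antisym : ∀ x y → O x y ≡ true → O y x ≡ false

-- A directed walk with  suc s  arcs: vertices w 0, …, w (suc s).
IsDirPath : {V : Set} (O : V → V → Bool) (s : ℕ) (w : Fin (suc (suc s)) → V) → Set
IsDirPath {V} O s w = ∀ (i : Fin (suc s)) → O (w (inject₁ i)) (w (suc i)) ≡ true

Acyclic : {V : Set} (O : V → V → Bool) → Set
Acyclic {V} O = ∀ (s : ℕ) (w : Fin (suc (suc s)) → V) → IsDirPath O s w →
                w zero ≢ w (fromℕ (suc s))

IsSemiTransitiveOrientation : {V : Set} (E : V → V → Bool) (O : V → V → Bool) → Set
IsSemiTransitiveOrientation {V} E O =
  IsOrientation E O × Acyclic O ×
  (∀ (s : ℕ) (w : Fin (suc (suc s)) → V) → IsDirPath O s w →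
     O (w zero) (w (fromℕ (suc s))) ≡ true →
     ∀ (i j : Fin (suc (suc s))) → toℕ i < toℕ j → O (w i) (w j) ≡ true)

SemiTransitive : {V : Set} (E : V → V → Bool) → Set
SemiTransitive {V} E = Σ (V → V → Bool) (λ O → IsSemiTransitiveOrientation E O)

-- Vertices: inj₁ i  is u_i ∈ C (clique), inj₂ j is v_j ∈ I (independent).
SplitVertex : ℕ → ℕ → Set
SplitVertex k t = Fin k ⊎ Fin t

splitAdj : {k t : ℕ} → (Fin k → Fin t → Bool) → SplitVertex k t → SplitVertex k t → Bool
splitAdj M (inj₁ i) (inj₁ i′) = not ⌊ i ≟ i′ ⌋
splitAdj M (inj₁ i) (inj₂ j)  = M i j
splitAdj M (inj₂ j) (inj₁ i)  = M i j
splitAdj M (inj₂ j) (inj₂ j′) = false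

NoFullColumn : {k t : ℕ} → (Fin k → Fin t → Bool) → Set
NoFullColumn {k} {t} M = ∀ (j : Fin t) → Σ (Fin k) (λ i → M i j ≡ false)

-- Matrix conditions (rows indexed 0 … k-1 top to bottom)

-- The entries equal to b in column c occupy consecutive rows
-- (the empty set counts as consecutive).
ConsecutiveValue : {k : ℕ} → (Fin k → Bool) → Bool → Set
ConsecutiveValue {k} c b =
  ∀ (i l j : Fin k) → toℕ i ≤ toℕ l → toℕ l ≤ toℕ j →
    c i ≡ b → c j ≡ b → c l ≡ b

ConditionI : {k t : ℕ} → (Fin k → Fin t → Bool) → Set
ConditionI {k} {t} P =
  ∀ (j : Fin t) → ConsecutiveValue (λ r → P r j) true ⊎ ConsecutiveValue (λ r → P r j) false

-- Column j has the form 1^a 0^b 1^c (top to bottom), a,b,c ≥ 1, a+b+c = k.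
-- In 0-indexed rows: row r has a one iff r < a or a + b ≤ r.
HasForm101 : {k t : ℕ} → (Fin k → Fin t → Bool) → Fin t → ℕ → ℕ → ℕ → Set
HasForm101 {k} {t} P j a b c =
  1 ≤ a × 1 ≤ b × 1 ≤ c × a + b + c ≡ k ×
  (∀ (r : Fin k) → P r j ≡ true → (toℕ r < a) ⊎ (a + b ≤ toℕ r)) ×
  (∀ (r : Fin k) → (toℕ r < a) ⊎ (a + b ≤ toℕ r) → P r j ≡ true)

-- Column j′ has ones in all (1-indexed) positions a, …, a+b+1,
-- i.e. 0-indexed rows a-1, …, a+b.
OnesFromTo : {k t : ℕ} → (Fin k → Fin t → Bool) → Fin t → ℕ → ℕ → Set
OnesFromTo {k} {t} P j′ a b =
  ∀ (r : Fin k) → a ∸ 1 ≤ toℕ r → toℕ r ≤ a + b → P r j′ ≡ true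

ConditionII : {k t : ℕ} → (Fin k → Fin t → Bool) → Set
ConditionII {k} {t} P =
  ∀ (j : Fin t) (a b c : ℕ) → HasForm101 P j a b c →
    ∀ (j′ : Fin t) → j′ ≢ j → ¬ OnesFromTo P j′ a b

permuteRows : {k t : ℕ} → Permutation′ k → (Fin k → Fin t → Bool) → Fin k → Fin t → Bool
permuteRows σ M r j = M (σ ⟨$⟩ʳ r) j

RowPermutable : {k t : ℕ} → (Fin k → Fin t → Bool) → Set
RowPermutable {k} {t} M =
  Σ (Permutation′ k) (λ σ → ConditionI (permuteRows σ M) × ConditionII (permuteRows σ M))

{-# OPTIONS --safe #-}
module Submission where

open import Defs
open import Data.Nat using (ℕ; zero; suc; _+_; _∸_; _≤_; _<_; z≤n; s≤s; z<s; s≤s⁻¹; _<?_; ⌊_/2⌋)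
open import Data.Nat.Properties
open import Relation.Binary.Definitions using (tri<; tri≈; tri>)
open import Data.Fin using (Fin; zero; suc; toℕ; fromℕ; fromℕ<; inject₁; punchOut)
open import Data.Fin.Properties
  using (toℕ-injective; toℕ-fromℕ<; toℕ-fromℕ; toℕ-inject₁; toℕ<n; any?; punchOut-injective; injective⇒≤)
import Data.Fin.Properties as Fin
open import Data.Fin.Subset using (Subset; _∈_; _⊂_; ⊤; ∣_∣)
open import Data.Fin.Subset.Properties using (∈⊤; ∣⊤∣≡n; p⊂q⇒∣p∣<∣q∣)
open import Data.Fin.Permutation using (Permutation′; _⟨$⟩ʳ_; _⟨$⟩ˡ_; permutation; inverseʳ; flip)
open import Function.Bundles using (Injection; _⇔_; mk⇔)
open import Function.Properties.Inverse using (↔⇒↣)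
open import Data.Vec using (tabulate)
open import Data.Vec.Properties using (lookup∘tabulate; []=⇒lookup; lookup⇒[]=)
open import Data.Vec.Functional using (_∷_; [])
open import Data.Bool using (Bool; true; false; not; _∧_; if_then_else_)
import Data.Bool.Properties as Bool
open import Data.Sum using (_⊎_; inj₁; inj₂; map₂)
open import Data.Product using (∃; ∃₂; _×_; _,_; proj₁; proj₂; uncurry)
open import Data.Empty using (⊥; ⊥-elim)
open import Function using (_∘_)
open import Relation.Binary.PropositionalEquality
open import Relation.Nullary using (¬_; Dec; does; yes; no)
open import Relation.Nullary.Decidable using (⌊_⌋; _×-dec_; dec-true; dec-false)


-- Necessity. Sort the rows by the orientation of the clique, which is
-- transitive. Every in-neighbour of a vertex v_j of the independent set then
-- precedes every out-neighbour, since otherwise there is a directed triangle,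
-- and the shortcut condition on paths with three arcs through v_j forces ones
-- between two in-neighbours, between two out-neighbours, above the
-- in-neighbours and below the out-neighbours, which is (i). For (ii), in a
-- column 1^a 0^b 1^c the vertex v_j is entered at row a and left at row
-- a+b+1; a second column with ones on rows a, …, a+b+1 must be entered and
-- left at the same rows, as otherwise a shortcut chord joins two vertices of
-- the independent set, so its zero, which exists by maximality of the clique,
-- lies inside that range.
--
-- Sufficiency. Orient the clique down the permuted matrix, and let v_j send
-- arcs exactly to the lower block of ones of a column 1^a 0^b 1^c, receiving
-- arcs from all its other neighbours. Inserting v_j into the row order just above
-- that block makes every arc point downwards, so the orientation is acyclic.
-- On a path with a shortcut, condition (ii) rules out two vertices of the
-- independent set, and the block structure given by (i) supplies every
-- remaining arc between the clique and the independent set.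

endpoint-or-interior : ∀ {a b c} → a ≤ b → b ≤ c → b ≡ a ⊎ b ≡ c ⊎ (a < b × b < c)
endpoint-or-interior a≤b b≤c with m≤n⇒m<n∨m≡n a≤b | m≤n⇒m<n∨m≡n b≤c
... | inj₂ a≡b | _       = inj₁ (sym a≡b)
... | inj₁ _   | inj₂ b≡c = inj₂ (inj₁ b≡c)
... | inj₁ a<b | inj₁ b<c = inj₂ (inj₂ (a<b , b<c))

bool-clash : ∀ {b} → b ≡ true → b ≡ false → ⊥
bool-clash refl ()

∧-intro : ∀ {x y} → x ≡ true → y ≡ true → x ∧ y ≡ true
∧-intro refl refl = refl

∧-elim : ∀ {x y} → x ∧ y ≡ true → x ≡ true × y ≡ true
∧-elim {true} {true} _ = refl , refl

∧-not-elim : ∀ {x y} → x ∧ not y ≡ true → x ≡ true × y ≡ false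
∧-not-elim {true} {false} _ = refl , refl

∧-true⇒∧-not-false : ∀ {x y} → x ∧ y ≡ true → x ∧ not y ≡ false
∧-true⇒∧-not-false {true} {true} _ = refl

∧-not-true⇒∧-false : ∀ {x y} → x ∧ not y ≡ true → x ∧ y ≡ false
∧-not-true⇒∧-false {true} {false} _ = refl

does-true⁻ : ∀ {A : Set} (a? : Dec A) → does a? ≡ true → A
does-true⁻ (yes a) _ = a

injective⇒surjective : ∀ {n} (f : Fin n → Fin n) → (∀ {x y} → f x ≡ f y → x ≡ y) →
                       ∀ y → ∃ λ x → f x ≡ y
injective⇒surjective {suc n} f f-inj y with any? (λ x → f x Fin.≟ y)
... | yes hit = hit
... | no miss = ⊥-elim (<-irrefl refl (injective⇒≤ g-inj))
  where
  y≢f : ∀ x → y ≢ f x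
  y≢f x y≡fx = miss (x , sym y≡fx)
  g : Fin (suc n) → Fin n
  g x = punchOut (y≢f x)
  g-inj : ∀ {a b} → g a ≡ g b → a ≡ b
  g-inj = f-inj ∘ punchOut-injective (y≢f _) (y≢f _)

-- n when f is nowhere true
firstTrue : ∀ {n} → (Fin n → Bool) → ℕ
firstTrue {zero}  f = zero
firstTrue {suc n} f = if f zero then zero else suc (firstTrue (f ∘ suc))

firstTrue-≤ : ∀ {n} (f : Fin n → Bool) {r} → f r ≡ true → firstTrue f ≤ toℕ r
firstTrue-≤ {suc n} f {zero} fr rewrite fr = z≤n
firstTrue-≤ {suc n} f {suc r} fr with f zero
... | true  = z≤n
... | false = s≤s (firstTrue-≤ (f ∘ suc) fr)

firstTrue-< : ∀ {n} (f : Fin n → Bool) → firstTrue f < n → ∃ λ r → toℕ r ≡ firstTrue f × f r ≡ true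
firstTrue-< {suc n} f first<n with f zero in f₀
... | true  = zero , refl , f₀
... | false with r , toℕ-r , fr ← firstTrue-< (f ∘ suc) (s≤s⁻¹ first<n) = suc r , cong suc toℕ-r , fr

<firstTrue : ∀ {n} (f : Fin n → Bool) {r} → toℕ r < firstTrue f → f r ≡ false
<firstTrue f {r} r<first with f r in fr
... | false = refl
... | true  = ⊥-elim (<⇒≱ r<first (firstTrue-≤ f fr))

double : ℕ → ℕ
double zero    = zero
double (suc n) = suc (suc (double n))

double-mono-≤ : ∀ {m n} → m ≤ n → double m ≤ double n
double-mono-≤ z≤n       = z≤n
double-mono-≤ (s≤s m≤n) = s≤s (s≤s (double-mono-≤ m≤n))

⌊double/2⌋ : ∀ n → ⌊ double n /2⌋ ≡ n
⌊double/2⌋ zero    = refl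
⌊double/2⌋ (suc n) = cong suc (⌊double/2⌋ n)

⌊1+double/2⌋ : ∀ n → ⌊ suc (double n) /2⌋ ≡ n
⌊1+double/2⌋ zero    = refl
⌊1+double/2⌋ (suc n) = cong suc (⌊1+double/2⌋ n)

clamp : ∀ {m} → ℕ → Fin (suc m)
clamp {m} n with n <? suc m
... | yes n<1+m = fromℕ< n<1+m
... | no  _     = zero

clamp-toℕ : ∀ {m} (i : Fin (suc m)) {n} → toℕ i ≡ n → clamp n ≡ i
clamp-toℕ {m} i {n} toℕ-i with n <? suc m
... | yes n<1+m = toℕ-injective (trans (toℕ-fromℕ< n<1+m) (sym toℕ-i))
... | no  n≮1+m = ⊥-elim (n≮1+m (subst (_< suc m) toℕ-i (toℕ<n i)))

module SemiTransitiveOrientation {V : Set} {E O : V → V → Bool}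
                                 (st : IsSemiTransitiveOrientation E O) where
  open IsOrientation (proj₁ st) public

  asymmetric : ∀ {x y} → O x y ≡ true → O y x ≡ true → ⊥
  asymmetric {x} {y} xy yx with () ← trans (sym yx) (antisym x y xy)

  irreflexive : ∀ x → O x x ≡ false
  irreflexive x with O x x in xx
  ... | false = refl
  ... | true  = ⊥-elim (asymmetric xx xx)

  no-3-cycle : ∀ {a b c} → O a b ≡ true → O b c ≡ true → O c a ≡ true → ⊥
  no-3-cycle {a} {b} {c} ab bc ca = proj₁ (proj₂ st) 2 (a ∷ b ∷ c ∷ a ∷ []) arcs refl
    where
    arcs : IsDirPath O 2 (a ∷ b ∷ c ∷ a ∷ [])
    arcs zero             = ab
    arcs (suc zero)       = bc
    arcs (suc (suc zero)) = ca

  transitive-on-edge : ∀ {x y z} → E x z ≡ true → O x y ≡ true → O y z ≡ true → O x z ≡ true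
  transitive-on-edge {x} {y} {z} xz xy yz with covers x z xz
  ... | inj₁ x→z = x→z
  ... | inj₂ z→x = ⊥-elim (no-3-cycle xy yz z→x)

  shortcut-chords : ∀ {a b c d} → O a b ≡ true → O b c ≡ true → O c d ≡ true →
                    O a d ≡ true → O a c ≡ true × O b d ≡ true
  shortcut-chords {a} {b} {c} {d} ab bc cd ad =
    chord zero (suc (suc zero)) (s≤s z≤n) , chord (suc zero) (suc (suc (suc zero))) (s≤s (s≤s z≤n))
    where
    walk : Fin 4 → V
    walk = a ∷ b ∷ c ∷ d ∷ []
    arcs : IsDirPath O 2 walk
    arcs zero             = ab
    arcs (suc zero)       = bc
    arcs (suc (suc zero)) = cd
    chord : ∀ i i′ → toℕ i < toℕ i′ → O (walk i) (walk i′) ≡ true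
    chord = proj₂ (proj₂ st) 2 walk arcs ad

pullback : ∀ {V W : Set} {E O : V → V → Bool} {E′ : W → W → Bool} (f : W → V) →
           (∀ x y → E′ x y ≡ E (f x) (f y)) →
           IsSemiTransitiveOrientation E O →
           IsSemiTransitiveOrientation E′ (λ x y → O (f x) (f y))
pullback {O = O} f E′≡E (orientation , acyclic , shortcut) =
  record { sub     = λ x y xy → trans (E′≡E x y) (sub (f x) (f y) xy)
         ; covers  = λ x y xy → covers (f x) (f y) (trans (sym (E′≡E x y)) xy)
         ; antisym = λ x y → antisym (f x) (f y) } ,
  (λ s w arcs w₀≡wₗ → acyclic s (f ∘ w) arcs (cong f w₀≡wₗ)) ,
  (λ s w arcs → shortcut s (f ∘ w) arcs)
  where open IsOrientation orientation

module DirectedWalk {V : Set} (O : V → V → Bool) {s} (w : Fin (suc (suc s)) → V)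
                    (arcs : IsDirPath O s w) where

  W : ℕ → V
  W n = w (clamp n)

  W-toℕ : ∀ i {n} → toℕ i ≡ n → W n ≡ w i
  W-toℕ i toℕ-i = cong w (clamp-toℕ i toℕ-i)

  W-arc : ∀ n → n < suc s → O (W n) (W (suc n)) ≡ true
  W-arc n n<1+s = subst₂ (λ x y → O (w x) (w y) ≡ true)
    (sym (clamp-toℕ (inject₁ i) (trans (toℕ-inject₁ i) toℕ-i)))
    (sym (clamp-toℕ (suc i) (cong suc toℕ-i))) (arcs i)
    where
    i : Fin (suc s)
    i = fromℕ< n<1+s
    toℕ-i : toℕ i ≡ n
    toℕ-i = toℕ-fromℕ< n<1+s

module Potential {V : Set} {O : V → V → Bool} (f : V → ℕ)
                 (increasing : ∀ x y → O x y ≡ true → f x < f y) where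

  potential-< : ∀ {m} (W : ℕ → V) → (∀ n → n < m → O (W n) (W (suc n)) ≡ true) →
                ∀ {n n′} → n < n′ → n′ ≤ m → f (W n) < f (W n′)
  potential-< W arcs {n} {suc n′} (s≤s n≤n′) 1+n′≤m with m≤n⇒m<n∨m≡n n≤n′
  ... | inj₂ refl = increasing _ _ (arcs n 1+n′≤m)
  ... | inj₁ n<n′ = <-trans (potential-< W arcs n<n′ (<⇒≤ 1+n′≤m)) (increasing _ _ (arcs n′ 1+n′≤m))

  potential-≤ : ∀ {m} (W : ℕ → V) → (∀ n → n < m → O (W n) (W (suc n)) ≡ true) →
                ∀ {n n′} → n ≤ n′ → n′ ≤ m → f (W n) ≤ f (W n′)
  potential-≤ W arcs n≤n′ n′≤m with m≤n⇒m<n∨m≡n n≤n′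
  ... | inj₂ refl = ≤-refl
  ... | inj₁ n<n′ = <⇒≤ (potential-< W arcs n<n′ n′≤m)

  acyclic : Acyclic O
  acyclic s w arcs first≡last = <-irrefl (cong f first≡last)
    (subst₂ (λ x y → f x < f y) (W-toℕ zero refl) (W-toℕ (fromℕ (suc s)) (toℕ-fromℕ (suc s)))
            (potential-< W W-arc (s≤s z≤n) ≤-refl))
    where open DirectedWalk O w arcs

module Sorting {k} (R : Fin k → Fin k → Bool)
               (irrefl : ∀ x → R x x ≡ false)
               (R-trans : ∀ {x y z} → R x y ≡ true → R y z ≡ true → R x z ≡ true)
               (connex : ∀ {x y} → x ≢ y → R x y ≡ true ⊎ R y x ≡ true) where

  predecessors : Fin k → Subset k
  predecessors y = tabulate (λ x → R x y)

  ∈-predecessors⁺ : ∀ {x y} → R x y ≡ true → x ∈ predecessors y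
  ∈-predecessors⁺ {x} xy = lookup⇒[]= x _ (trans (lookup∘tabulate _ x) xy)

  ∈-predecessors⁻ : ∀ {x y} → x ∈ predecessors y → R x y ≡ true
  ∈-predecessors⁻ {x} x∈ = trans (sym (lookup∘tabulate _ x)) ([]=⇒lookup x∈)

  ∉-predecessors-self : ∀ y → ¬ y ∈ predecessors y
  ∉-predecessors-self y y∈ with () ← trans (sym (∈-predecessors⁻ y∈)) (irrefl y)

  predecessors-⊂ : ∀ {x y} → R x y ≡ true → predecessors x ⊂ predecessors y
  predecessors-⊂ {x} xy =
    (λ z∈ → ∈-predecessors⁺ (R-trans (∈-predecessors⁻ z∈) xy)) ,
    x , ∈-predecessors⁺ xy , ∉-predecessors-self x

  rank : Fin k → Fin k
  rank y = fromℕ< (subst (∣ predecessors y ∣ <_) (∣⊤∣≡n k)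
                    (p⊂q⇒∣p∣<∣q∣ ((λ _ → ∈⊤) , y , ∈⊤ , ∉-predecessors-self y)))

  toℕ-rank : ∀ y → toℕ (rank y) ≡ ∣ predecessors y ∣
  toℕ-rank y = toℕ-fromℕ< _

  rank-mono : ∀ {x y} → R x y ≡ true → toℕ (rank x) < toℕ (rank y)
  rank-mono {x} {y} xy rewrite toℕ-rank x | toℕ-rank y = p⊂q⇒∣p∣<∣q∣ (predecessors-⊂ xy)

  rank-injective : ∀ {x y} → rank x ≡ rank y → x ≡ y
  rank-injective {x} {y} rx≡ry with x Fin.≟ y
  ... | yes x≡y = x≡y
  ... | no x≢y with connex x≢y
  ...   | inj₁ xy = ⊥-elim (<-irrefl (cong toℕ rx≡ry) (rank-mono xy))
  ...   | inj₂ yx = ⊥-elim (<-irrefl (cong toℕ (sym rx≡ry)) (rank-mono yx))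

  unrank : Fin k → Fin k
  unrank r = proj₁ (injective⇒surjective rank rank-injective r)

  rank-unrank : ∀ r → rank (unrank r) ≡ r
  rank-unrank r = proj₂ (injective⇒surjective rank rank-injective r)

  unrank-injective : ∀ {r r′} → unrank r ≡ unrank r′ → r ≡ r′
  unrank-injective {r} {r′} u≡u′ = begin
    r                ≡⟨ rank-unrank r ⟨
    rank (unrank r)  ≡⟨ cong rank u≡u′ ⟩
    rank (unrank r′) ≡⟨ rank-unrank r′ ⟩
    r′               ∎
    where open ≡-Reasoning

  sorting : Permutation′ k
  sorting = permutation unrank rank (rank-injective ∘ rank-unrank ∘ rank) rank-unrank

  sorting-sorts : ∀ {r r′} → toℕ r < toℕ r′ → R (sorting ⟨$⟩ʳ r) (sorting ⟨$⟩ʳ r′) ≡ true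
  sorting-sorts {r} {r′} r<r′ with unrank r Fin.≟ unrank r′
  ... | yes u≡u′ = ⊥-elim (<-irrefl (cong toℕ (unrank-injective u≡u′)) r<r′)
  ... | no u≢u′ with connex u≢u′
  ...   | inj₁ uu′ = uu′
  ...   | inj₂ u′u = ⊥-elim (<-asym r<r′ (subst₂ (λ a b → toℕ a < toℕ b)
                                           (rank-unrank r′) (rank-unrank r) (rank-mono u′u)))

≢⇒adjacent : ∀ {k} {i i′ : Fin k} → i ≢ i′ → not ⌊ i Fin.≟ i′ ⌋ ≡ true
≢⇒adjacent {i = i} {i′} i≢i′ with i Fin.≟ i′
... | yes i≡i′ = ⊥-elim (i≢i′ i≡i′)
... | no  _    = refl

adjacent⇒≢ : ∀ {k} {i i′ : Fin k} → not ⌊ i Fin.≟ i′ ⌋ ≡ true → i ≢ i′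
adjacent⇒≢ {i = i} adj refl with i Fin.≟ i
... | no i≢i = i≢i refl

relabelClique : ∀ {k t} → Permutation′ k → SplitVertex k t → SplitVertex k t
relabelClique π (inj₁ i) = inj₁ (π ⟨$⟩ʳ i)
relabelClique π (inj₂ j) = inj₂ j

⌊≟⌋-injective : ∀ {k} {f : Fin k → Fin k} → (∀ {x y} → f x ≡ f y → x ≡ y) →
                ∀ x y → ⌊ x Fin.≟ y ⌋ ≡ ⌊ f x Fin.≟ f y ⌋
⌊≟⌋-injective {f = f} f-inj x y with x Fin.≟ y | f x Fin.≟ f y
... | yes _    | yes _     = refl
... | no  _    | no  _     = refl
... | yes refl | no fx≢fx  = ⊥-elim (fx≢fx refl)
... | no  x≢y  | yes fx≡fy = ⊥-elim (x≢y (f-inj fx≡fy))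

splitAdj-relabelClique : ∀ {k t} {M N : Fin k → Fin t → Bool} (π : Permutation′ k) →
                         (∀ i j → M (π ⟨$⟩ʳ i) j ≡ N i j) →
                         ∀ x y → splitAdj N x y ≡ splitAdj M (relabelClique π x) (relabelClique π y)
splitAdj-relabelClique π _ (inj₁ i) (inj₁ i′) =
  cong not (⌊≟⌋-injective (Injection.injective (↔⇒↣ π)) i i′)
splitAdj-relabelClique π M∘π≡N (inj₁ i) (inj₂ j) = sym (M∘π≡N i j)
splitAdj-relabelClique π M∘π≡N (inj₂ j) (inj₁ i) = sym (M∘π≡N i j)
splitAdj-relabelClique π _ (inj₂ j) (inj₂ j′) = refl

noFullColumn-permuteRows : ∀ {k t} {M : Fin k → Fin t → Bool} (σ : Permutation′ k) →
                           NoFullColumn M → NoFullColumn (permuteRows σ M)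
noFullColumn-permuteRows {M = M} σ no-full j with i , zero-i ← no-full j =
  σ ⟨$⟩ˡ i , trans (cong (λ i′ → M i′ j) (inverseʳ σ)) zero-i

consecutive-from-interior : ∀ {k} (col : Fin k → Bool) b →
                            (∀ {x l y} → toℕ x < toℕ l → toℕ l < toℕ y →
                                         col x ≡ b → col y ≡ b → col l ≡ b) →
                            ConsecutiveValue col b
consecutive-from-interior col b interior i l i′ i≤l l≤i′ bᵢ bᵢ′ with endpoint-or-interior i≤l l≤i′
... | inj₁ l≡i rewrite toℕ-injective l≡i = bᵢ
... | inj₂ (inj₁ l≡i′) rewrite toℕ-injective l≡i′ = bᵢ′
... | inj₂ (inj₂ (i<l , l<i′)) = interior i<l l<i′ bᵢ bᵢ′

module SortedOrientation {k t} (P : Fin k → Fin t → Bool)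
       {O : SplitVertex k t → SplitVertex k t → Bool}
       (st : IsSemiTransitiveOrientation (splitAdj P) O)
       (row-order : ∀ {r r′} → toℕ r < toℕ r′ → O (inj₁ r) (inj₁ r′) ≡ true) where
  open SemiTransitiveOrientation st

  module Column (j : Fin t) where
    Into OutOf : Fin k → Set
    Into r = O (inj₁ r) (inj₂ j) ≡ true
    OutOf r = O (inj₂ j) (inj₁ r) ≡ true

    one⇒into⊎outOf : ∀ {r} → P r j ≡ true → Into r ⊎ OutOf r
    one⇒into⊎outOf {r} = covers (inj₁ r) (inj₂ j)

    into⇒one : ∀ {r} → Into r → P r j ≡ true
    into⇒one {r} = sub (inj₁ r) (inj₂ j)

    outOf⇒one : ∀ {r} → OutOf r → P r j ≡ true
    outOf⇒one {r} = sub (inj₂ j) (inj₁ r)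

    outOf-unless-into : ∀ {r} → ¬ Into r → P r j ≡ true → OutOf r
    outOf-unless-into ¬into one with one⇒into⊎outOf one
    ... | inj₁ into  = ⊥-elim (¬into into)
    ... | inj₂ outOf = outOf

    into-unless-outOf : ∀ {r} → ¬ OutOf r → P r j ≡ true → Into r
    into-unless-outOf ¬outOf one with one⇒into⊎outOf one
    ... | inj₁ into  = into
    ... | inj₂ outOf = ⊥-elim (¬outOf outOf)

    into<outOf : ∀ {x y} → Into x → OutOf y → toℕ x < toℕ y
    into<outOf {x} {y} into outOf with <-cmp (toℕ x) (toℕ y)
    ... | tri< x<y _ _ = x<y
    ... | tri≈ _ x≡y _ rewrite toℕ-injective x≡y = ⊥-elim (asymmetric into outOf)
    ... | tri> _ _ y<x = ⊥-elim (no-3-cycle into outOf (row-order y<x))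

    into-gap : ∀ {x l y} → Into x → toℕ x < toℕ l → toℕ l < toℕ y → Into y → P l j ≡ true
    into-gap into x<l l<y into′ =
      into⇒one (proj₂ (shortcut-chords (row-order x<l) (row-order l<y) into′ into))

    outOf-gap : ∀ {x l y} → OutOf x → toℕ x < toℕ l → toℕ l < toℕ y → OutOf y → P l j ≡ true
    outOf-gap outOf x<l l<y outOf′ =
      outOf⇒one (proj₁ (shortcut-chords outOf (row-order x<l) (row-order l<y) outOf′))

    one-above-into : ∀ {z x y} → toℕ z ≤ toℕ x → Into x → OutOf y → P z j ≡ true
    one-above-into z≤x into outOf with m≤n⇒m<n∨m≡n z≤x
    ... | inj₂ z≡x rewrite toℕ-injective z≡x = into⇒one into
    ... | inj₁ z<x = into⇒one (proj₁ (shortcut-chords (row-order z<x) into outOf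
                                        (row-order (<-trans z<x (into<outOf into outOf)))))

    one-below-outOf : ∀ {x y z} → Into x → OutOf y → toℕ y ≤ toℕ z → P z j ≡ true
    one-below-outOf into outOf y≤z with m≤n⇒m<n∨m≡n y≤z
    ... | inj₂ y≡z rewrite toℕ-injective y≡z = outOf⇒one outOf
    ... | inj₁ y<z = outOf⇒one (proj₂ (shortcut-chords into outOf (row-order y<z)
                                         (row-order (<-trans (into<outOf into outOf) y<z))))

    zero-between : ∀ {x y z} → P z j ≡ false → Into x → OutOf y → toℕ x < toℕ z × toℕ z < toℕ y
    zero-between zero-z into outOf =
      ≰⇒> (λ z≤x → bool-clash (one-above-into z≤x into outOf) zero-z) ,
      ≰⇒> (λ y≤z → bool-clash (one-below-outOf into outOf y≤z) zero-z)

    zeros-consecutive : ∀ {x y} → Into x → OutOf y → ConsecutiveValue (λ r → P r j) false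
    zeros-consecutive into outOf i l i′ i≤l l≤i′ zeroᵢ zeroᵢ′ with P l j in oneₗ
    ... | false = refl
    ... | true with one⇒into⊎outOf oneₗ
    ...   | inj₁ intoₗ  = ⊥-elim (<⇒≱ (proj₁ (zero-between zeroᵢ intoₗ outOf)) i≤l)
    ...   | inj₂ outOfₗ = ⊥-elim (<⇒≱ (proj₂ (zero-between zeroᵢ′ into outOfₗ)) l≤i′)

    circular : ConsecutiveValue (λ r → P r j) true ⊎ ConsecutiveValue (λ r → P r j) false
    circular with any? (λ r → O (inj₁ r) (inj₂ j) Bool.≟ true)
                | any? (λ r → O (inj₂ j) (inj₁ r) Bool.≟ true)
    ... | yes (_ , into) | yes (_ , outOf) = inj₂ (zeros-consecutive into outOf)
    ... | no no-into | _ = inj₁ (consecutive-from-interior _ true λ x<l l<y oneₓ oneᵧ →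
            outOf-gap (only-outOf oneₓ) x<l l<y (only-outOf oneᵧ))
      where
      only-outOf : ∀ {r} → P r j ≡ true → OutOf r
      only-outOf = outOf-unless-into (no-into ∘ (_ ,_))
    ... | yes _ | no no-outOf = inj₁ (consecutive-from-interior _ true λ x<l l<y oneₓ oneᵧ →
            into-gap (only-into oneₓ) x<l l<y (only-into oneᵧ))
      where
      only-into : ∀ {r} → P r j ≡ true → Into r
      only-into = into-unless-outOf (no-outOf ∘ (_ ,_))

    one-zero-one⇒into×outOf : ∀ {x z y} → P x j ≡ true → P z j ≡ false → P y j ≡ true →
                              toℕ x < toℕ z → toℕ z < toℕ y → Into x × OutOf y
    one-zero-one⇒into×outOf oneₓ zero-z oneᵧ x<z z<y with one⇒into⊎outOf oneₓ | one⇒into⊎outOf oneᵧ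
    ... | inj₁ into  | inj₂ outOf  = into , outOf
    ... | inj₁ into  | inj₁ into′  = ⊥-elim (bool-clash (into-gap into x<z z<y into′) zero-z)
    ... | inj₂ outOf | inj₂ outOf′ = ⊥-elim (bool-clash (outOf-gap outOf x<z z<y outOf′) zero-z)
    ... | inj₂ outOf | inj₁ into   = ⊥-elim (<-asym (into<outOf into outOf) (<-trans x<z z<y))

  no-arc-between-columns : ∀ {j j′} → O (inj₂ j) (inj₂ j′) ≡ true → ⊥
  no-arc-between-columns {j} {j′} arc with () ← sub (inj₂ j) (inj₂ j′) arc

  straddle : ∀ {j j′ x y} → Column.Into j x → Column.OutOf j y →
             P x j′ ≡ true → P y j′ ≡ true → Column.Into j′ x × Column.OutOf j′ y
  straddle {j} {j′} into outOf oneₓ oneᵧ with C′.one⇒into⊎outOf oneₓ | C′.one⇒into⊎outOf oneᵧ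
    where module C′ = Column j′
  ... | inj₁ into′  | inj₂ outOf′ = into′ , outOf′
  ... | inj₁ into′  | inj₁ into″  =
    ⊥-elim (no-arc-between-columns (proj₂ (shortcut-chords into outOf into″ into′)))
  ... | inj₂ outOf′ | inj₂ outOf″ =
    ⊥-elim (no-arc-between-columns (proj₁ (shortcut-chords outOf′ into outOf outOf″)))
  ... | inj₂ outOf′ | inj₁ into″  =
    ⊥-elim (<-asym (Column.into<outOf j′ into″ outOf′) (Column.into<outOf j into outOf))

  gap-not-covered : NoFullColumn P → ∀ {j j′ x z y} →
                    P x j ≡ true → P z j ≡ false → P y j ≡ true → toℕ x < toℕ z → toℕ z < toℕ y →
                    ¬ (∀ r → toℕ x ≤ toℕ r → toℕ r ≤ toℕ y → P r j′ ≡ true)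
  gap-not-covered no-full {j} {j′} {x} {z} {y} oneₓ zero-z oneᵧ x<z z<y ones′
    with into , outOf ← Column.one-zero-one⇒into×outOf j oneₓ zero-z oneᵧ x<z z<y
    with into′ , outOf′ ← straddle into outOf (ones′ x ≤-refl (<⇒≤ (<-trans x<z z<y)))
                                            (ones′ y (<⇒≤ (<-trans x<z z<y)) ≤-refl)
    with z′ , zero-z′ ← no-full j′
    with x<z′ , z′<y ← Column.zero-between j′ zero-z′ into′ outOf′
    = bool-clash (ones′ z′ (<⇒≤ x<z′) (<⇒≤ z′<y)) zero-z′

  conditionII : NoFullColumn P → ConditionII P
  conditionII no-full j a b c (1≤a , 1≤b , 1≤c , a+b+c≡k , one⇒outside , outside⇒one) j′ _ ones′ =
    gap-not-covered no-full (outside⇒one x (inj₁ x<a)) zero-z (outside⇒one y (inj₂ a+b≤y)) x<z z<y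
      (λ r x≤r r≤y → ones′ r (subst (_≤ toℕ r) toℕ-x x≤r) (subst (toℕ r ≤_) toℕ-y r≤y))
    where
    a+b<k : a + b < k
    a+b<k = subst (a + b <_) a+b+c≡k (m<m+n (a + b) 1≤c)
    a∸1<a : a ∸ 1 < a
    a∸1<a = ∸-monoʳ-< z<s 1≤a
    a<a+b : a < a + b
    a<a+b = m<m+n a 1≤b
    x z y : Fin k
    x = fromℕ< (<-trans a∸1<a (<-trans a<a+b a+b<k))
    z = fromℕ< (<-trans a<a+b a+b<k)
    y = fromℕ< a+b<k
    toℕ-x : toℕ x ≡ a ∸ 1
    toℕ-x = toℕ-fromℕ< _
    toℕ-z : toℕ z ≡ a
    toℕ-z = toℕ-fromℕ< _
    toℕ-y : toℕ y ≡ a + b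
    toℕ-y = toℕ-fromℕ< _
    x<a : toℕ x < a
    x<a = subst (_< a) (sym toℕ-x) a∸1<a
    x<z : toℕ x < toℕ z
    x<z = subst (toℕ x <_) (sym toℕ-z) x<a
    z<y : toℕ z < toℕ y
    z<y = subst₂ _<_ (sym toℕ-z) (sym toℕ-y) a<a+b
    a+b≤y : a + b ≤ toℕ y
    a+b≤y = ≤-reflexive (sym toℕ-y)
    zero-z : P z j ≡ false
    zero-z with P z j in one-z
    ... | false = refl
    ... | true with one⇒outside z one-z
    ...   | inj₁ z<a   = ⊥-elim (<-irrefl toℕ-z z<a)
    ...   | inj₂ a+b≤z = ⊥-elim (<⇒≱ a<a+b (subst (a + b ≤_) toℕ-z a+b≤z))

module Gaps {k} (col : Fin k → Bool) where

  AfterGap : Fin k → Set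
  AfterGap r = ∃₂ λ i l → toℕ i < toℕ l × toℕ l < toℕ r × col i ≡ true × col l ≡ false

  afterGap? : ∀ r → Dec (AfterGap r)
  afterGap? r = any? λ i → any? λ l →
    toℕ i <? toℕ l ×-dec toℕ l <? toℕ r ×-dec col i Bool.≟ true ×-dec col l Bool.≟ false

  afterGap : Fin k → Bool
  afterGap r = does (afterGap? r)

  afterGap⁺ : ∀ {r} → AfterGap r → afterGap r ≡ true
  afterGap⁺ {r} = dec-true (afterGap? r)

  afterGap⁻ : ∀ {r} → afterGap r ≡ true → AfterGap r
  afterGap⁻ {r} = does-true⁻ (afterGap? r)

  ¬afterGap⁻ : ∀ {r} → afterGap r ≡ false → ¬ AfterGap r
  ¬afterGap⁻ ¬gap gap = bool-clash (afterGap⁺ gap) ¬gap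

  afterGap-mono : ∀ {r r′} → toℕ r ≤ toℕ r′ → AfterGap r → AfterGap r′
  afterGap-mono r≤r′ (i , l , i<l , l<r , oneᵢ , zeroₗ) = i , l , i<l , <-≤-trans l<r r≤r′ , oneᵢ , zeroₗ

  ones-between : ∀ {x y r} → col x ≡ true → col y ≡ true → ¬ AfterGap y →
                 toℕ x ≤ toℕ r → toℕ r ≤ toℕ y → col r ≡ true
  ones-between {x} {y} {r} oneₓ oneᵧ ¬gap x≤r r≤y with endpoint-or-interior x≤r r≤y
  ... | inj₁ r≡x rewrite toℕ-injective r≡x = oneₓ
  ... | inj₂ (inj₁ r≡y) rewrite toℕ-injective r≡y = oneᵧ
  ... | inj₂ (inj₂ (x<r , r<y)) with col r in oneᵣ
  ...   | true  = refl
  ...   | false = ⊥-elim (¬gap (x , r , x<r , r<y , oneₓ , oneᵣ))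

  bottomStart : ℕ
  bottomStart = firstTrue (λ r → col r ∧ afterGap r)

  bottomStart-≤ : ∀ {r} → col r ≡ true → AfterGap r → bottomStart ≤ toℕ r
  bottomStart-≤ one gap = firstTrue-≤ _ (∧-intro one (afterGap⁺ gap))

  bottomStart-row : ∀ {r} → bottomStart ≤ toℕ r →
                    ∃ λ s → toℕ s ≡ bottomStart × col s ≡ true × AfterGap s
  bottomStart-row {r} start≤r with s , toℕ-s , one∧gap ← firstTrue-< _ (≤-<-trans start≤r (toℕ<n r))
    = s , toℕ-s , proj₁ (∧-elim one∧gap) , afterGap⁻ (proj₂ (∧-elim one∧gap))

  afterGap-from-bottomStart : ∀ {r} → bottomStart ≤ toℕ r → AfterGap r
  afterGap-from-bottomStart start≤r = let (s , toℕ-s , _ , gap) = bottomStart-row start≤r in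
    afterGap-mono (≤-trans (≤-reflexive toℕ-s) start≤r) gap

  <bottomStart : ∀ {r} → ¬ AfterGap r → toℕ r < bottomStart
  <bottomStart ¬gap = ≰⇒> (¬gap ∘ afterGap-from-bottomStart)

  record Shape101 : Set where
    field
      a b c           : ℕ
      1≤a             : 1 ≤ a
      1≤b             : 1 ≤ b
      1≤c             : 1 ≤ c
      a+b+c≡k         : a + b + c ≡ k
      one⇒outside     : ∀ r → col r ≡ true → toℕ r < a ⊎ a + b ≤ toℕ r
      outside⇒one     : ∀ r → toℕ r < a ⊎ a + b ≤ toℕ r → col r ≡ true
      bottomStart≡a+b : bottomStart ≡ a + b

    one-above : ∀ {r} → toℕ r < a → col r ≡ true
    one-above = outside⇒one _ ∘ inj₁

    no-gap⇒above : ∀ {r} → col r ≡ true → ¬ AfterGap r → toℕ r < a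
    no-gap⇒above one ¬gap with one⇒outside _ one
    ... | inj₁ r<a   = r<a
    ... | inj₂ a+b≤r =
      ⊥-elim (¬gap (afterGap-from-bottomStart (subst (_≤ _) (sym bottomStart≡a+b) a+b≤r)))

  module FromOneZeroOne (zeros : ConsecutiveValue col false) {i₀ l₀ q : Fin k}
                        (i₀<l₀ : toℕ i₀ < toℕ l₀) (l₀<q : toℕ l₀ < toℕ q)
                        (one-i₀ : col i₀ ≡ true) (zero-l₀ : col l₀ ≡ false) (one-q : col q ≡ true) where

    firstZero : ℕ
    firstZero = firstTrue (not ∘ col)

    one-above-firstZero : ∀ {r} → toℕ r < firstZero → col r ≡ true
    one-above-firstZero {r} r<first = Bool.not-injective (<firstTrue (not ∘ col) r<first)

    firstZero-row : ∃ λ z → toℕ z ≡ firstZero × col z ≡ false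
    firstZero-row with z , toℕ-z , not-zero ← firstTrue-< (not ∘ col)
                         (≤-<-trans (firstTrue-≤ (not ∘ col) (cong not zero-l₀)) (toℕ<n l₀))
      = z , toℕ-z , Bool.not-injective not-zero

    i₀<firstZero : toℕ i₀ < firstZero
    i₀<firstZero = ≰⇒> λ first≤i₀ →
      let (z , toℕ-z , zero-z) = firstZero-row in
      bool-clash one-i₀
        (zeros z i₀ l₀ (subst (_≤ toℕ i₀) (sym toℕ-z) first≤i₀) (<⇒≤ i₀<l₀) zero-z zero-l₀)

    afterGap-beyond-firstZero : ∀ {r} → firstZero < toℕ r → AfterGap r
    afterGap-beyond-firstZero first<r =
      let (z , toℕ-z , zero-z) = firstZero-row in
      i₀ , z , subst (toℕ i₀ <_) (sym toℕ-z) i₀<firstZero , subst (_< _) (sym toℕ-z) first<r ,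
      one-i₀ , zero-z

    bottomStart≤q : bottomStart ≤ toℕ q
    bottomStart≤q = bottomStart-≤ one-q (i₀ , l₀ , i₀<l₀ , l₀<q , one-i₀ , zero-l₀)

    bottomStart<k : bottomStart < k
    bottomStart<k = ≤-<-trans bottomStart≤q (toℕ<n q)

    zero-before-bottomStart : ∃ λ l → toℕ l < bottomStart × col l ≡ false
    zero-before-bottomStart
      with s , toℕ-s , _ , (_ , l , _ , l<s , _ , zero-l) ← bottomStart-row bottomStart≤q
      = l , subst (toℕ l <_) toℕ-s l<s , zero-l

    firstZero<bottomStart : firstZero < bottomStart
    firstZero<bottomStart = let (l , l<start , zero-l) = zero-before-bottomStart in
      ≤-<-trans (firstTrue-≤ (not ∘ col) (cong not zero-l)) l<start

    one-from-bottomStart : ∀ {r} → bottomStart ≤ toℕ r → col r ≡ true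
    one-from-bottomStart {r} start≤r with col r in zero-r
    ... | true  = refl
    ... | false with s , toℕ-s , one-s , _ ← bottomStart-row bottomStart≤q =
      let (l , l<start , zero-l) = zero-before-bottomStart in
      ⊥-elim (bool-clash one-s (zeros l s r (<⇒≤ (subst (toℕ l <_) (sym toℕ-s) l<start))
                                             (subst (_≤ toℕ r) (sym toℕ-s) start≤r) zero-l zero-r))

    one⇒outside : ∀ {r} → col r ≡ true → toℕ r < firstZero ⊎ bottomStart ≤ toℕ r
    one⇒outside {r} one-r with toℕ r <? firstZero
    ... | yes r<first = inj₁ r<first
    ... | no  r≮first = inj₂ (bottomStart-≤ one-r (afterGap-beyond-firstZero first<r))
      where
      first<r : firstZero < toℕ r
      first<r = ≤∧≢⇒< (≮⇒≥ r≮first) λ first≡r →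
        let (z , toℕ-z , zero-z) = firstZero-row in
        bool-clash one-r (subst (λ x → col x ≡ false) (toℕ-injective (trans toℕ-z first≡r)) zero-z)

    shape101 : Shape101
    shape101 = record
      { a = firstZero ; b = bottomStart ∸ firstZero ; c = k ∸ bottomStart
      ; 1≤a = ≤-<-trans z≤n i₀<firstZero
      ; 1≤b = m<n⇒0<n∸m firstZero<bottomStart
      ; 1≤c = m<n⇒0<n∸m bottomStart<k
      ; a+b+c≡k = trans (cong (_+ (k ∸ bottomStart)) a+b≡start) (m+[n∸m]≡n (<⇒≤ bottomStart<k))
      ; one⇒outside = λ r one-r → map₂ (subst (_≤ toℕ r) (sym a+b≡start)) (one⇒outside one-r)
      ; outside⇒one = λ { r (inj₁ r<a) → one-above-firstZero r<a
                        ; r (inj₂ a+b≤r) → one-from-bottomStart (subst (_≤ toℕ r) a+b≡start a+b≤r) }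
      ; bottomStart≡a+b = sym a+b≡start }
      where
      a+b≡start : firstZero + (bottomStart ∸ firstZero) ≡ bottomStart
      a+b≡start = m+[n∸m]≡n (<⇒≤ firstZero<bottomStart)

  afterGap⇒shape101 : ConsecutiveValue col true ⊎ ConsecutiveValue col false →
                      ∀ {q} → col q ≡ true → AfterGap q → Shape101
  afterGap⇒shape101 (inj₁ ones) one-q (i , l , i<l , l<q , one-i , zero-l) =
    ⊥-elim (bool-clash (ones i l _ (<⇒≤ i<l) (<⇒≤ l<q) one-i one-q) zero-l)
  afterGap⇒shape101 (inj₂ zeros) one-q (i , l , i<l , l<q , one-i , zero-l) =
    FromOneZeroOne.shape101 zeros i<l l<q one-i zero-l one-q

module CanonicalOrientation {k t} (P : Fin k → Fin t → Bool) where
  open module Column (j : Fin t) = Gaps (λ r → P r j) public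

  -- In a column 1^a 0^b 1^c, P r j ∧ afterGap j r holds exactly on the lower block of ones.
  O : SplitVertex k t → SplitVertex k t → Bool
  O (inj₁ r) (inj₁ r′) = does (toℕ r <? toℕ r′)
  O (inj₁ r) (inj₂ j)  = P r j ∧ not (afterGap j r)
  O (inj₂ j) (inj₁ r)  = P r j ∧ afterGap j r
  O (inj₂ _) (inj₂ _)  = false

  clique-arc⁺ : ∀ {r r′} → toℕ r < toℕ r′ → O (inj₁ r) (inj₁ r′) ≡ true
  clique-arc⁺ {r} {r′} = dec-true (toℕ r <? toℕ r′)

  clique-arc⁻ : ∀ {r r′} → O (inj₁ r) (inj₁ r′) ≡ true → toℕ r < toℕ r′
  clique-arc⁻ {r} {r′} = does-true⁻ (toℕ r <? toℕ r′)

  Into OutOf : Fin t → Fin k → Set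
  Into j r  = O (inj₁ r) (inj₂ j) ≡ true
  OutOf j r = O (inj₂ j) (inj₁ r) ≡ true

  into⁺ : ∀ {j r} → P r j ≡ true → ¬ AfterGap j r → Into j r
  into⁺ {j} {r} one ¬gap = ∧-intro one (cong not (dec-false (afterGap? j r) ¬gap))

  into⁻ : ∀ {j r} → Into j r → P r j ≡ true × ¬ AfterGap j r
  into⁻ {j} arc = proj₁ (∧-not-elim arc) , ¬afterGap⁻ j (proj₂ (∧-not-elim arc))

  outOf⁺ : ∀ {j r} → P r j ≡ true → AfterGap j r → OutOf j r
  outOf⁺ {j} one gap = ∧-intro one (afterGap⁺ j gap)

  outOf⁻ : ∀ {j r} → OutOf j r → P r j ≡ true × AfterGap j r
  outOf⁻ {j} arc = proj₁ (∧-elim arc) , afterGap⁻ j (proj₂ (∧-elim arc))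

  isOrientation : IsOrientation (splitAdj P) O
  isOrientation = record { sub = sub ; covers = covers ; antisym = antisym }
    where
    sub : ∀ x y → O x y ≡ true → splitAdj P x y ≡ true
    sub (inj₁ r) (inj₁ r′) arc = ≢⇒adjacent λ { refl → <-irrefl refl (clique-arc⁻ {r} arc) }
    sub (inj₁ r) (inj₂ j)  arc = proj₁ (into⁻ {j} arc)
    sub (inj₂ j) (inj₁ r)  arc = proj₁ (outOf⁻ {j} arc)

    covers : ∀ x y → splitAdj P x y ≡ true → O x y ≡ true ⊎ O y x ≡ true
    covers (inj₁ r) (inj₁ r′) adj with <-cmp (toℕ r) (toℕ r′)
    ... | tri< r<r′ _ _ = inj₁ (clique-arc⁺ r<r′)
    ... | tri> _ _ r′<r = inj₂ (clique-arc⁺ r′<r)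
    ... | tri≈ _ r≡r′ _ = ⊥-elim (adjacent⇒≢ adj (toℕ-injective r≡r′))
    covers (inj₁ r) (inj₂ j) one with afterGap j r
    ... | true  = inj₂ (∧-intro one refl)
    ... | false = inj₁ (∧-intro one refl)
    covers (inj₂ j) (inj₁ r) one with afterGap j r
    ... | true  = inj₁ (∧-intro one refl)
    ... | false = inj₂ (∧-intro one refl)

    antisym : ∀ x y → O x y ≡ true → O y x ≡ false
    antisym (inj₁ r) (inj₁ r′) r<r′ = dec-false (toℕ r′ <? toℕ r) (<⇒≯ (clique-arc⁻ r<r′))
    antisym (inj₁ r) (inj₂ j)  arc = ∧-not-true⇒∧-false {P r j} arc
    antisym (inj₂ j) (inj₁ r)  arc = ∧-true⇒∧-not-false {P r j} arc

  position : SplitVertex k t → ℕ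
  position (inj₁ r) = suc (double (toℕ r))
  position (inj₂ j) = double (bottomStart j)

  position-increases : ∀ x y → O x y ≡ true → position x < position y
  position-increases (inj₁ r) (inj₁ r′) arc = s≤s (<⇒≤ (double-mono-≤ (clique-arc⁻ arc)))
  position-increases (inj₁ r) (inj₂ j)  arc = double-mono-≤ (<bottomStart j (proj₂ (into⁻ arc)))
  position-increases (inj₂ j) (inj₁ r)  arc = s≤s (double-mono-≤ (uncurry (bottomStart-≤ j) (outOf⁻ arc)))

  open Potential {O = O} position position-increases public using (acyclic)

  into-column⇒clique : ∀ {j} x → O x (inj₂ j) ≡ true → ∃ λ p → x ≡ inj₁ p × Into j p
  into-column⇒clique (inj₁ p) arc = p , refl , arc

  outOf-column⇒clique : ∀ {j} y → O (inj₂ j) y ≡ true → ∃ λ q → y ≡ inj₁ q × OutOf j q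
  outOf-column⇒clique (inj₁ q) arc = q , refl , arc

module CanonicalSemiTransitivity {k t} {P : Fin k → Fin t → Bool}
                                 (conditionI : ConditionI P) (conditionII : ConditionII P) where
  open CanonicalOrientation P

  outOf⇒shape : ∀ {j q} → OutOf j q → Shape101 j
  outOf⇒shape {j} arc = uncurry (afterGap⇒shape101 j (conditionI j)) (outOf⁻ arc)

  module _ {j q} (outOf : OutOf j q) where
    open Shape101 j (outOf⇒shape outOf)

    one-above-into : ∀ {p r} → Into j p → toℕ r ≤ toℕ p → P r j ≡ true
    one-above-into into r≤p = one-above (≤-<-trans r≤p (uncurry no-gap⇒above (into⁻ into)))

    outOf-from-bottomStart : ∀ {r} → bottomStart j ≤ toℕ r → OutOf j r
    outOf-from-bottomStart start≤r =
      outOf⁺ (outside⇒one _ (inj₂ (subst (_≤ _) bottomStart≡a+b start≤r)))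
             (afterGap-from-bottomStart j start≤r)

    straddled⇒uncovered : ∀ {p j′} → Into j p → j′ ≢ j →
                          ¬ (∀ r → toℕ p ≤ toℕ r → toℕ r ≤ toℕ q → P r j′ ≡ true)
    straddled⇒uncovered into j′≢j covered =
      conditionII j a b c (1≤a , 1≤b , 1≤c , a+b+c≡k , one⇒outside , outside⇒one) _ j′≢j
        λ r a∸1≤r r≤a+b →
          covered r (≤-trans (suc[m]≤n⇒m≤pred[n] (uncurry no-gap⇒above (into⁻ into))) a∸1≤r)
                    (≤-trans r≤a+b (subst (_≤ _) bottomStart≡a+b (uncurry (bottomStart-≤ j) (outOf⁻ outOf))))

  module Shortcut {m} (W : ℕ → SplitVertex k t) (arcs : ∀ n → n < m → O (W n) (W (suc n)) ≡ true)
                  (shortcut : O (W 0) (W m) ≡ true) where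
    open Potential {O = O} position position-increases

    preceded : ∀ {n j} → n < m → W (suc n) ≡ inj₂ j → ∃ λ p → W n ≡ inj₁ p × Into j p
    preceded {n} n<m W1+n = into-column⇒clique (W n) (subst (λ y → O (W n) y ≡ true) W1+n (arcs n n<m))

    followed : ∀ {n j} → n < m → W n ≡ inj₂ j → ∃ λ q → W (suc n) ≡ inj₁ q × OutOf j q
    followed {n} n<m Wn =
      outOf-column⇒clique (W (suc n)) (subst (λ x → O x (W (suc n)) ≡ true) Wn (arcs n n<m))

    position-≤ : ∀ {n n′ x y} → n ≤ n′ → n′ ≤ m → W n ≡ x → W n′ ≡ y → position x ≤ position y
    position-≤ n≤n′ n′≤m refl refl = potential-≤ W arcs n≤n′ n′≤m

    position-< : ∀ {n n′ x y} → n < n′ → n′ ≤ m → W n ≡ x → W n′ ≡ y → position x < position y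
    position-< n<n′ n′≤m refl refl = potential-< W arcs n<n′ n′≤m

    row-≤ : ∀ {n n′ r r′} → n ≤ n′ → n′ ≤ m → W n ≡ inj₁ r → W n′ ≡ inj₁ r′ → toℕ r ≤ toℕ r′
    row-≤ {r = r} {r′} n≤n′ n′≤m Wn Wn′ =
      subst₂ _≤_ (⌊1+double/2⌋ (toℕ r)) (⌊1+double/2⌋ (toℕ r′))
                 (⌊n/2⌋-mono (position-≤ n≤n′ n′≤m Wn Wn′))

    row-< : ∀ {n n′ r r′} → n < n′ → n′ ≤ m → W n ≡ inj₁ r → W n′ ≡ inj₁ r′ → toℕ r < toℕ r′
    row-< {r = r} {r′} n<n′ n′≤m Wn Wn′ =
      subst₂ _≤_ (cong suc (⌊double/2⌋ (toℕ r))) (⌊1+double/2⌋ (toℕ r′))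
                 (⌊n/2⌋-mono (position-< n<n′ n′≤m Wn Wn′))

    bottomStart-≤-row : ∀ {n n′ j r} → n ≤ n′ → n′ ≤ m → W n ≡ inj₂ j → W n′ ≡ inj₁ r →
                        bottomStart j ≤ toℕ r
    bottomStart-≤-row {j = j} {r} n≤n′ n′≤m Wn Wn′ =
      subst₂ _≤_ (⌊double/2⌋ (bottomStart j)) (⌊1+double/2⌋ (toℕ r))
                 (⌊n/2⌋-mono (position-≤ n≤n′ n′≤m Wn Wn′))

    column-visited-once : ∀ {n n′ j j′} → n < n′ → n′ ≤ m → W n ≡ inj₂ j → W n′ ≡ inj₂ j′ → j ≢ j′
    column-visited-once n<n′ n′≤m Wn Wn′ refl = <-irrefl refl (position-< n<n′ n′≤m Wn Wn′)

    distinct-kinds : ∀ {n n′ r j} → W n ≡ inj₁ r → W n′ ≡ inj₂ j → n ≢ n′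
    distinct-kinds Wn Wn′ refl with () ← trans (sym Wn) Wn′

    ones-before-column : ∀ {n n′ i p j} → n ≤ n′ → suc n′ ≤ m → W n ≡ inj₁ i → W n′ ≡ inj₁ p →
                         Into j p → W (suc n′) ≡ inj₂ j →
                         ∀ {r} → toℕ i ≤ toℕ r → toℕ r ≤ toℕ p → P r j ≡ true
    ones-before-column {n} {n′} {j = j} n≤n′ 1+n′≤m Wn Wn′ into W1+n′ i≤r r≤p
      with m≤n⇒m<n∨m≡n 1+n′≤m
    ... | inj₁ 1+n′<m with _ , _ , outOf ← followed 1+n′<m W1+n′ = one-above-into outOf into r≤p
    ... | inj₂ refl
      with i₀ , W0 , into₀ ← into-column⇒clique (W 0) (subst (λ y → O (W 0) y ≡ true) W1+n′ shortcut)
      = ones-between j (proj₁ (into⁻ into₀)) (proj₁ (into⁻ into)) (proj₂ (into⁻ into))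
                     (≤-trans (row-≤ z≤n (≤-trans n≤n′ (n≤1+n n′)) W0 Wn) i≤r) r≤p

    clique-before-column : ∀ {n n′ i j} → n < n′ → n′ ≤ m → W n ≡ inj₁ i → W n′ ≡ inj₂ j → Into j i
    clique-before-column {n} {suc n′} {j = j} n<1+n′ 1+n′≤m Wn W1+n′
      with p , Wn′ , into ← preceded 1+n′≤m W1+n′ =
      into⁺ (ones-before-column n≤n′ 1+n′≤m Wn Wn′ into W1+n′ ≤-refl i≤p)
            (λ gap → proj₂ (into⁻ into) (afterGap-mono j i≤p gap))
      where
      n≤n′ = s≤s⁻¹ n<1+n′
      i≤p = row-≤ n≤n′ (<⇒≤ 1+n′≤m) Wn Wn′

    column-before-clique : ∀ {n n′ i j} → n < n′ → n′ ≤ m → W n ≡ inj₂ j → W n′ ≡ inj₁ i → OutOf j i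
    column-before-clique n<n′ n′≤m Wn Wn′ with _ , _ , outOf ← followed (<-≤-trans n<n′ n′≤m) Wn =
      outOf-from-bottomStart outOf (bottomStart-≤-row (<⇒≤ n<n′) n′≤m Wn Wn′)

    no-two-columns : ∀ {n n′ j j′} → n < n′ → n′ ≤ m → W n ≡ inj₂ j → W n′ ≡ inj₂ j′ → ⊥
    no-two-columns {zero} {suc n′} 0<1+n′ 1+n′≤m W0 W1+n′ with m≤n⇒m<n∨m≡n 1+n′≤m
    ... | inj₂ refl with () ← trans (sym (subst₂ (λ x y → O x y ≡ true) W0 W1+n′ shortcut)) refl
    ... | inj₁ 1+n′<m
      with p , Wn′ , into ← preceded 1+n′≤m W1+n′
         | _ , _ , outOf ← followed 1+n′<m W1+n′
         | _ , _ , outOf₀ ← followed (<-trans 0<1+n′ 1+n′<m) W0 =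
      straddled⇒uncovered outOf into (column-visited-once 0<1+n′ 1+n′≤m W0 W1+n′) λ r p≤r _ →
        proj₁ (outOf⁻ (outOf-from-bottomStart outOf₀
                        (≤-trans (bottomStart-≤-row z≤n (<⇒≤ 1+n′≤m) W0 Wn′) p≤r)))
    no-two-columns {suc n} {suc n′} {j} {j′} 1+n<1+n′ 1+n′≤m W1+n W1+n′
      with p₁ , Wn , into₁ ← preceded (<⇒≤ (<-≤-trans 1+n<1+n′ 1+n′≤m)) W1+n
         | q₁ , W2+n , outOf₁ ← followed (<-≤-trans 1+n<1+n′ 1+n′≤m) W1+n
         | p₂ , Wn′ , into₂ ← preceded 1+n′≤m W1+n′ =
      straddled⇒uncovered outOf₁ into₁ (column-visited-once 1+n<1+n′ 1+n′≤m W1+n W1+n′ ∘ sym)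
        λ r p₁≤r r≤q₁ →
        ones-before-column (≤-trans (n≤1+n n) n<n′) 1+n′≤m Wn Wn′ into₂ W1+n′ p₁≤r (≤-trans r≤q₁ q₁≤p₂)
      where
      n<n′ : n < n′
      n<n′ = s≤s⁻¹ 1+n<1+n′
      q₁≤p₂ : toℕ q₁ ≤ toℕ p₂
      q₁≤p₂ = row-≤ (≤∧≢⇒< n<n′ (distinct-kinds Wn′ W1+n ∘ sym)) (<⇒≤ 1+n′≤m) W2+n Wn′

    shortcut-arcs : ∀ {n n′} → n < n′ → n′ ≤ m → O (W n) (W n′) ≡ true
    shortcut-arcs {n} {n′} n<n′ n′≤m with W n in Wn | W n′ in Wn′
    ... | inj₁ r | inj₁ r′ = clique-arc⁺ (row-< n<n′ n′≤m Wn Wn′)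
    ... | inj₁ i | inj₂ j  = clique-before-column n<n′ n′≤m Wn Wn′
    ... | inj₂ j | inj₁ i  = column-before-clique n<n′ n′≤m Wn Wn′
    ... | inj₂ j | inj₂ j′ = ⊥-elim (no-two-columns n<n′ n′≤m Wn Wn′)

  isSemiTransitive : IsSemiTransitiveOrientation (splitAdj P) O
  isSemiTransitive = isOrientation , acyclic , shortcut-closed
    where
    shortcut-closed : ∀ s (w : Fin (suc (suc s)) → SplitVertex k t) → IsDirPath O s w →
                      O (w zero) (w (fromℕ (suc s))) ≡ true →
                      ∀ i i′ → toℕ i < toℕ i′ → O (w i) (w i′) ≡ true
    shortcut-closed s w arcs shortcut i i′ i<i′ =
      subst₂ (λ x y → O x y ≡ true) (W-toℕ i refl) (W-toℕ i′ refl)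
        (Shortcut.shortcut-arcs W W-arc W-shortcut i<i′ (s≤s⁻¹ (toℕ<n i′)))
      where
      open DirectedWalk O w arcs
      W-shortcut : O (W 0) (W (suc s)) ≡ true
      W-shortcut = subst₂ (λ x y → O x y ≡ true)
        (sym (W-toℕ zero refl)) (sym (W-toℕ (fromℕ (suc s)) (toℕ-fromℕ (suc s)))) shortcut

semiTransitive⇒rowPermutable : ∀ {k t} {M : Fin k → Fin t → Bool} →
                               NoFullColumn M → SemiTransitive (splitAdj M) → RowPermutable M
semiTransitive⇒rowPermutable {M = M} no-full (O , st) =
  sorting , circular , conditionII (noFullColumn-permuteRows sorting no-full)
  where
  open SemiTransitiveOrientation st

  clique-trans : ∀ {i i′ i″} → O (inj₁ i) (inj₁ i′) ≡ true → O (inj₁ i′) (inj₁ i″) ≡ true →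
                 O (inj₁ i) (inj₁ i″) ≡ true
  clique-trans {i} {i′} {i″} ii′ i′i″ with i Fin.≟ i″
  ... | yes refl  = ⊥-elim (asymmetric ii′ i′i″)
  ... | no  i≢i″ = transitive-on-edge (≢⇒adjacent i≢i″) ii′ i′i″

  open Sorting (λ i i′ → O (inj₁ i) (inj₁ i′)) (irreflexive ∘ inj₁) clique-trans
               (λ {i} {i′} i≢i′ → covers (inj₁ i) (inj₁ i′) (≢⇒adjacent i≢i′))
  open SortedOrientation (permuteRows sorting M)
         (pullback (relabelClique sorting) (splitAdj-relabelClique sorting λ _ _ → refl) st) sorting-sorts
  open Column using (circular)

rowPermutable⇒semiTransitive : ∀ {k t} {M : Fin k → Fin t → Bool} →
                               RowPermutable M → SemiTransitive (splitAdj M)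
rowPermutable⇒semiTransitive {M = M} (σ , conditionI , conditionII) =
  _ , pullback (relabelClique (flip σ))
               (splitAdj-relabelClique (flip σ) λ i j → cong (λ i′ → M i′ j) (inverseʳ σ))
               (CanonicalSemiTransitivity.isSemiTransitive conditionI conditionII)

theorem2 : (k t : ℕ) (M : Fin k → Fin t → Bool) → NoFullColumn M →
    SemiTransitive (splitAdj M) ⇔ RowPermutable M
theorem2 k t M no-full = mk⇔ (semiTransitive⇒rowPermutable no-full) rowPermutable⇒semiTransitive
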